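{- If $T$ is a tree of order $n\geq 3$, then $tpc(T)=\Delta(T)+1$, where $\Delta(T)$ is the maximum degree of $T$.
   Context: All graphs are simple, finite and undirected. A graph is total-colored if every vertex and every edge receives a color. A path $v_1v_2\ldots v_s$ in a total-colored graph is a total proper path if (i) any two adjacent edges on the path have different colors, (ii) any two adjacent internal vertices of the path (vertices among $v_2,\ldots,v_{s-1}$) have different colors, and (iii) every internal vertex of the path has a color different from the colors of its two incident edges on the path. A total-colored graph is total proper connected if every two vertices are joined by a total proper path. For a connected graph $G$, the total proper connection number $tpc(G)$ is the smallest number of colors in a total-coloring making $G$ total proper connected. -}

module Defs where

open import Data.Nat using (ℕ; zero; suc; _⊔_; _≤_; _<_; _+_)
open import Data.Fin using (Fin)
open import Data.Bool using (Bool; true; false; if_then_else_)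
open import Data.List using (List; []; _∷_; length; map; foldr; allFin; head; last)
open import Data.Nat.ListAction using (sum)
open import Data.List.Relation.Unary.Unique.Propositional using (Unique)
open import Data.Maybe using (just)
open import Data.Product using (Σ; _×_; ∃)
open import Data.Unit using (⊤)
open import Data.Empty using (⊥)
open import Relation.Nullary using (¬_)
open import Relation.Binary.PropositionalEquality using (_≡_; _≢_)

record Graph (n : ℕ) : Set where
  field
    adj   : Fin n → Fin n → Bool
    sym   : ∀ i j → adj i j ≡ adj j i
    irrefl : ∀ i → adj i i ≡ false
open Graph public

module _ {n : ℕ} (G : Graph n) where

  Adj : Fin n → Fin n → Set
  Adj i j = adj G i j ≡ true

  IsWalk : List (Fin n) → Set
  IsWalk []              = ⊤
  IsWalk (a ∷ [])        = ⊤
  IsWalk (a ∷ b ∷ rest)  = Adj a b × IsWalk (b ∷ rest)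

  IsPath : List (Fin n) → Set
  IsPath p = IsWalk p × Unique p

  PathFromTo : Fin n → Fin n → List (Fin n) → Set
  PathFromTo u v p = IsPath p × head p ≡ just u × last p ≡ just v

  Connected : Set
  Connected = ∀ u v → ∃ λ p → PathFromTo u v p

  IsCycle : List (Fin n) → Set
  IsCycle []       = ⊥
  IsCycle (a ∷ as) = 3 ≤ length (a ∷ as) × IsPath (a ∷ as)
                     × Σ (Fin n) (λ z → last (a ∷ as) ≡ just z × Adj z a)

  Acyclic : Set
  Acyclic = ∀ p → ¬ IsCycle p

  IsTree : Set
  IsTree = Connected × Acyclic

  degree : Fin n → ℕ
  degree i = sum (map (λ j → if adj G i j then 1 else 0) (allFin n))

  maxDegree : ℕ
  maxDegree = foldr _⊔_ 0 (map degree (allFin n))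

  -- A total coloring with (at most) k colors: colors of vertices and of edges.
  -- Edge colors are given by a symmetric function (its values on non-adjacent
  -- pairs are irrelevant).
  record TotalColoring (k : ℕ) : Set where
    field
      vcol : Fin n → Fin k
      ecol : Fin n → Fin n → Fin k
      esym : ∀ i j → ecol i j ≡ ecol j i

  module _ {k : ℕ} (c : TotalColoring k) where
    open TotalColoring c

    InternalOK : Fin n → Fin n → Fin n → Set
    InternalOK a b c' = ecol a b ≢ ecol b c' × vcol b ≢ ecol a b × vcol b ≢ ecol b c'

    TotalProperSeq : List (Fin n) → Set
    TotalProperSeq (a ∷ b ∷ c' ∷ d ∷ rest) =
      InternalOK a b c' × vcol b ≢ vcol c' × TotalProperSeq (b ∷ c' ∷ d ∷ rest)
    TotalProperSeq (a ∷ b ∷ c' ∷ []) = InternalOK a b c'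
    TotalProperSeq _ = ⊤

    TotalProperConnected : Set
    TotalProperConnected =
      ∀ u v → ∃ λ p → PathFromTo u v p × TotalProperSeq p

  TPCIs : ℕ → Set
  TPCIs m = (Σ (TotalColoring m) TotalProperConnected)
          × (∀ k → k < m → ¬ Σ (TotalColoring k) TotalProperConnected)

module Submission where

-- Lower bound: in a tree the only path between two neighbours a, a′ of v is a v a′, so in a total
-- proper colouring the edges at v have pairwise distinct colours, all different from the colour
-- of v. As n ≥ 3 some vertex has two neighbours, hence Δ ≥ 2 and a vertex of degree Δ sees Δ + 1
-- colours.
-- Upper bound: root the tree at a leaf and give each vertex the weight Σ (2 + rank of the child
-- among its siblings), summed over the edges of its path to the root. Modulo Δ + 1, colour each
-- vertex by its weight plus one and each edge by the weight of its lower endpoint. Around a vertex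
-- v this uses weight v (parent edge), weight v + 1 (v itself) and weight v + 2, …, weight v + 1 + c
-- (edges to its c children), where c ≤ Δ − 1 because v has a parent or is the leaf root. These are
-- distinct modulo Δ + 1, and a child's colour differs from its parent's, so every path is total
-- proper.

open import Defs hiding (sym)
open import Data.Bool using (Bool; true; false; if_then_else_)
import Data.Bool.Properties as Bool
open import Data.Empty using (⊥-elim)
open import Data.Fin using (Fin; toℕ) renaming (zero to 0F; suc to sucF)
open import Data.Fin.Properties using (_≟_; injective⇒≤; toℕ-fromℕ<)
open import Data.List using (List; []; _∷_; _++_; [_]; _∷ʳ_; length; map; foldr; allFin; last; drop; filter; lookup; tabulate)
open import Data.List.Membership.Propositional using (_∈_; _∉_)
open import Data.List.Membership.Propositional.Properties using (∈-∃++; ∈-allFin; ∈-filter⁺; ∈-filter⁻; ∈-lookup)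
open import Data.List.Properties using (++-assoc; ∷-injectiveˡ; ∷ʳ-injectiveˡ; length-map; length-filter; filter-notAll; ≡-dec)
open import Data.List.Relation.Unary.All as All using (All; []; _∷_)
open import Data.List.Relation.Unary.All.Properties using (All¬⇒¬Any; ¬Any⇒All¬; all-filter; ++⁻ˡ; map⁺)
open import Data.List.Relation.Unary.AllPairs using ([]; _∷_)
open import Data.List.Relation.Unary.Any as Any using (here; there)
open import Data.List.Relation.Unary.Unique.Propositional using (Unique)
open import Data.List.Relation.Unary.Unique.Propositional.Properties using (allFin⁺; filter⁺)
open import Data.Maybe using (just)
open import Data.Maybe.Properties using (just-injective)
open import Data.Nat using (ℕ; zero; suc; _+_; _*_; _∸_; _⊔_; _≤_; _<_; z≤n; s≤s; NonZero; >-nonZero; >-nonZero⁻¹)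
open import Data.Nat.DivMod using (_%_; _/_; _mod_; m≡m%n+[m/n]*n)
open import Data.Nat.Divisibility using (_∣_; divides; ∣m+n∣m⇒∣n; n∣m*n; >⇒∤)
open import Data.Nat.ListAction using (sum)
import Data.Nat.Properties as ℕ
open import Algebra.Properties.CommutativeSemigroup ℕ.+-commutativeSemigroup using (xy∙z≈xz∙y)
open import Data.Product using (Σ; _×_; ∃; ∃₂; _,_; proj₁; proj₂)
open import Data.Sum using (_⊎_; inj₁; inj₂)
open import Data.Unit using (tt)
open import Relation.Binary.Definitions using (DecidableEquality)
open import Relation.Binary.PropositionalEquality using (_≡_; _≢_; refl; sym; trans; cong; subst; module ≡-Reasoning)
open import Relation.Nullary using (¬_; Dec; yes; no; does)

module _ {A : Set} where

  ∈-last : ∀ (x : A) xs {z} → last (x ∷ xs) ≡ just z → z ∈ x ∷ xs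
  ∈-last x []       refl = here refl
  ∈-last x (y ∷ xs) eq   = there (∈-last y xs eq)

  last-++-∷ : ∀ (xs : List A) y ys → last (xs ++ y ∷ ys) ≡ last (y ∷ ys)
  last-++-∷ []           y ys = refl
  last-++-∷ (x ∷ [])     y ys = refl
  last-++-∷ (x ∷ z ∷ xs) y ys = last-++-∷ (z ∷ xs) y ys

  last-∷ʳ : ∀ (xs : List A) x → last (xs ∷ʳ x) ≡ just x
  last-∷ʳ xs x = last-++-∷ xs x []

  Unique-++⁻ˡ : ∀ (xs : List A) {ys} → Unique (xs ++ ys) → Unique xs
  Unique-++⁻ˡ []       _          = []
  Unique-++⁻ˡ (x ∷ xs) (x∉ ∷ xs!) = ++⁻ˡ xs x∉ ∷ Unique-++⁻ˡ xs xs!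

  2≤length : ∀ {xs : List A} {x y} → x ∈ xs → y ∈ xs → x ≢ y → 2 ≤ length xs
  2≤length {_ ∷ _ ∷ _} _          _          _   = s≤s (s≤s z≤n)
  2≤length {_ ∷ []}    (here refl) (here refl) x≢y = ⊥-elim (x≢y refl)

  two-distinct : ∀ {P : A → Set} {xs} → All P xs → Unique xs → 2 ≤ length xs → ∃₂ λ x y → P x × P y × x ≢ y
  two-distinct (px ∷ py ∷ _) ((x≢y ∷ _) ∷ _) _           = _ , _ , px , py , x≢y
  two-distinct (_ ∷ [])      _               (s≤s ())

  length≤1 : ∀ {xs : List A} → Unique xs → (∀ {x y} → x ∈ xs → y ∈ xs → x ≡ y) → length xs ≤ 1
  length≤1 {[]}        _            _     = z≤n
  length≤1 {_ ∷ []}    _            _     = s≤s z≤n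
  length≤1 {_ ∷ _ ∷ _} ((x≢y ∷ _) ∷ _) equal = ⊥-elim (x≢y (equal (here refl) (there (here refl))))

  Unique-lookup-injective : ∀ {xs : List A} → Unique xs → ∀ {i j} → lookup xs i ≡ lookup xs j → i ≡ j
  Unique-lookup-injective (_ ∷ _)    {0F}     {0F}     _  = refl
  Unique-lookup-injective (x∉ ∷ _)   {0F}     {sucF j} eq = ⊥-elim (All.lookup x∉ (∈-lookup j) eq)
  Unique-lookup-injective (x∉ ∷ _)   {sucF i} {0F}     eq = ⊥-elim (All.lookup x∉ (∈-lookup i) (sym eq))
  Unique-lookup-injective (_ ∷ xs!)  {sucF i} {sucF j} eq = cong sucF (Unique-lookup-injective xs! eq)

  Unique-map⁺ : ∀ {B : Set} {P : A → Set} {f : A → B} {xs} →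
                (∀ {x y} → P x → P y → x ≢ y → f x ≢ f y) → All P xs → Unique xs → Unique (map f xs)
  Unique-map⁺ f-inj []         []          = []
  Unique-map⁺ f-inj (px ∷ pxs) (x∉ ∷ xs!) =
    map⁺ (All.zipWith (λ (py , x≢y) → f-inj px py x≢y) (pxs , x∉)) ∷ Unique-map⁺ f-inj pxs xs!

Unique⇒length≤ : ∀ {k} (xs : List (Fin k)) → Unique xs → length xs ≤ k
Unique⇒length≤ xs xs! = injective⇒≤ (Unique-lookup-injective xs!)

module _ {A : Set} (_≟ᴬ_ : DecidableEquality A) where

  position : List A → A → ℕ
  position []       v = 0
  position (x ∷ xs) v = if does (x ≟ᴬ v) then 0 else suc (position xs v)

  position<length : ∀ {xs v} → v ∈ xs → position xs v < length xs
  position<length {x ∷ xs} {v} v∈ with x ≟ᴬ v | v∈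
  ... | yes _   | _          = s≤s z≤n
  ... | no x≢v  | here v≡x   = ⊥-elim (x≢v (sym v≡x))
  ... | no _    | there v∈xs = s≤s (position<length v∈xs)

  position-injective : ∀ {xs v w} → v ∈ xs → w ∈ xs → position xs v ≡ position xs w → v ≡ w
  position-injective {x ∷ xs} {v} {w} v∈ w∈ eq with x ≟ᴬ v | x ≟ᴬ w | v∈ | w∈
  ... | yes x≡v | yes x≡w | _          | _          = trans (sym x≡v) x≡w
  ... | no x≢v  | _       | here v≡x   | _          = ⊥-elim (x≢v (sym v≡x))
  ... | _       | no x≢w  | _          | here w≡x   = ⊥-elim (x≢w (sym w≡x))
  ... | no _    | no _    | there v∈xs | there w∈xs = position-injective v∈xs w∈xs (ℕ.suc-injective eq)

sum-indicator≡length-filter : ∀ {A : Set} (f : A → Bool) xs →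
  sum (map (λ x → if f x then 1 else 0) xs) ≡ length (filter (λ x → f x Bool.≟ true) xs)
sum-indicator≡length-filter f []       = refl
sum-indicator≡length-filter f (x ∷ xs) with f x
... | true  = cong suc (sum-indicator≡length-filter f xs)
... | false = sum-indicator≡length-filter f xs

module _ {A : Set} (f : A → ℕ) where

  ≤-foldr-⊔ : ∀ {x xs} → x ∈ xs → f x ≤ foldr _⊔_ 0 (map f xs)
  ≤-foldr-⊔ {xs = y ∷ xs} (here refl) = ℕ.m≤m⊔n (f y) _
  ≤-foldr-⊔ {xs = y ∷ xs} (there x∈)  = ℕ.≤-trans (≤-foldr-⊔ x∈) (ℕ.m≤n⊔m (f y) _)

  foldr-⊔-attained : ∀ x xs → ∃ λ y → foldr _⊔_ 0 (map f (x ∷ xs)) ≡ f y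
  foldr-⊔-attained x []       = x , ℕ.⊔-identityʳ (f x)
  foldr-⊔-attained x (z ∷ xs) with foldr-⊔-attained z xs | ℕ.⊔-sel (f x) (foldr _⊔_ 0 (map f (z ∷ xs)))
  ... | _ , _   | inj₁ max≡fx   = x , max≡fx
  ... | y , ≡fy | inj₂ max≡rest = y , trans max≡rest ≡fy

-- Modular arithmetic

module _ (k : ℕ) .{{_ : NonZero k}} where

  %-+-invariant⇒∣ : ∀ y d → (y + d) % k ≡ y % k → k ∣ d
  %-+-invariant⇒∣ y d eq = ∣m+n∣m⇒∣n (divides ((y + d) / k) (ℕ.+-cancelˡ-≡ (y % k) _ _ shift)) (n∣m*n (y / k))
    where
    open ≡-Reasoning
    shift : y % k + (y / k * k + d) ≡ y % k + (y + d) / k * k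
    shift = begin
      y % k + (y / k * k + d)        ≡⟨ ℕ.+-assoc (y % k) _ d ⟨
      y % k + y / k * k + d          ≡⟨ cong (_+ d) (m≡m%n+[m/n]*n y k) ⟨
      y + d                          ≡⟨ m≡m%n+[m/n]*n (y + d) k ⟩
      (y + d) % k + (y + d) / k * k  ≡⟨ cong (_+ (y + d) / k * k) eq ⟩
      y % k + (y + d) / k * k        ∎

  private
    +-%-injectiveʳ-≤ : ∀ x {a b} → a ≤ b → b < k → (x + a) % k ≡ (x + b) % k → a ≡ b
    +-%-injectiveʳ-≤ x {a} a≤b b<k eq with ℕ.m≤n⇒∃[o]m+o≡n a≤b
    ... | zero  , refl = sym (ℕ.+-identityʳ a)
    ... | suc d , refl = ⊥-elim (>⇒∤ (ℕ.≤-<-trans (ℕ.m≤n+m (suc d) a) b<k) (%-+-invariant⇒∣ (x + a) (suc d)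
                           (trans (cong (_% k) (ℕ.+-assoc x a (suc d))) (sym eq))))

  +-%-injectiveʳ : ∀ x {a b} → a < k → b < k → (x + a) % k ≡ (x + b) % k → a ≡ b
  +-%-injectiveʳ x {a} {b} a<k b<k eq with ℕ.≤-total a b
  ... | inj₁ a≤b = +-%-injectiveʳ-≤ x a≤b b<k eq
  ... | inj₂ b≤a = sym (+-%-injectiveʳ-≤ x b≤a a<k (sym eq))

module _ {n : ℕ} (G : Graph n) where

  Adj-sym : ∀ {a b} → Adj G a b → Adj G b a
  Adj-sym {a} {b} ab = trans (Graph.sym G b a) ab

  Adj⇒≢ : ∀ {a b} → Adj G a b → a ≢ b
  Adj⇒≢ {a} aa refl with trans (sym aa) (Graph.irrefl G a)
  ... | ()

  IsWalk-++⁻ˡ : ∀ xs {ys} → IsWalk G (xs ++ ys) → IsWalk G xs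
  IsWalk-++⁻ˡ []           _        = tt
  IsWalk-++⁻ˡ (x ∷ [])     _        = tt
  IsWalk-++⁻ˡ (x ∷ y ∷ xs) (xy , w) = xy , IsWalk-++⁻ˡ (y ∷ xs) w

  IsPath-∷ʳ⁻ : ∀ xs x ys → IsPath G (xs ++ x ∷ ys) → IsPath G (xs ∷ʳ x)
  IsPath-∷ʳ⁻ xs x ys path with w , xs! ← subst (IsPath G) (sym (++-assoc xs [ x ] ys)) path =
    IsWalk-++⁻ˡ (xs ∷ʳ x) w , Unique-++⁻ˡ (xs ∷ʳ x) xs!

  IsPath-∷ : ∀ {v x xs} → Adj G v x → v ∉ x ∷ xs → IsPath G (x ∷ xs) → IsPath G (v ∷ x ∷ xs)
  IsPath-∷ vx v∉ (w , xs!) = (vx , w) , (¬Any⇒All¬ _ v∉ ∷ xs!)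

  IsPath-edge : ∀ {a b} → Adj G a b → IsPath G (a ∷ b ∷ [])
  IsPath-edge ab = (ab , tt) , ((Adj⇒≢ ab ∷ []) ∷ [] ∷ [])

  neighbours : Fin n → List (Fin n)
  neighbours v = filter (λ w → adj G v w Bool.≟ true) (allFin n)

  degree≡length-neighbours : ∀ v → degree G v ≡ length (neighbours v)
  degree≡length-neighbours v = sum-indicator≡length-filter (adj G v) (allFin n)

  ∈-neighbours⁺ : ∀ {v w} → Adj G v w → w ∈ neighbours v
  ∈-neighbours⁺ {v} {w} vw = ∈-filter⁺ (λ w → adj G v w Bool.≟ true) (∈-allFin w) vw

  ∈-neighbours⁻ : ∀ {v w} → w ∈ neighbours v → Adj G v w
  ∈-neighbours⁻ {v} w∈ = proj₂ (∈-filter⁻ (λ w → adj G v w Bool.≟ true) {xs = allFin n} w∈)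

  neighbours-adjacent : ∀ v → All (Adj G v) (neighbours v)
  neighbours-adjacent v = all-filter (λ w → adj G v w Bool.≟ true) (allFin n)

  neighbours-unique : ∀ v → Unique (neighbours v)
  neighbours-unique v = filter⁺ (λ w → adj G v w Bool.≟ true) (allFin⁺ n)

  2≤degree : ∀ {v a b} → Adj G v a → Adj G v b → a ≢ b → 2 ≤ degree G v
  2≤degree {v} va vb a≢b =
    subst (2 ≤_) (sym (degree≡length-neighbours v)) (2≤length (∈-neighbours⁺ va) (∈-neighbours⁺ vb) a≢b)

  degree≤1 : ∀ {v} → (∀ {a b} → Adj G v a → Adj G v b → a ≡ b) → degree G v ≤ 1
  degree≤1 {v} equal = subst (_≤ 1) (sym (degree≡length-neighbours v))
    (length≤1 (neighbours-unique v) (λ a∈ b∈ → equal (∈-neighbours⁻ a∈) (∈-neighbours⁻ b∈)))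

module _ {n : ℕ} {G : Graph n} (connected : Connected G) where

  adjacent-or-branch : ∀ {u v} → u ≢ v → Adj G u v ⊎ ∃ λ b → 2 ≤ degree G b
  adjacent-or-branch {u} {v} u≢v with connected u v
  ... | [] , _ , () , _
  ... | _ ∷ [] , _ , refl , refl = ⊥-elim (u≢v refl)
  ... | _ ∷ _ ∷ [] , ((uv , _) , _) , refl , refl = inj₁ uv
  ... | _ ∷ b ∷ _ ∷ _ , ((ub , bc , _) , ((_ ∷ u≢c ∷ _) ∷ _)) , refl , _ =
    inj₂ (b , 2≤degree G (Adj-sym G ub) bc u≢c)

  branch-vertex : ∀ {x y z} → x ≢ z → y ≢ z → x ≢ y → ∃ λ b → 2 ≤ degree G b
  branch-vertex {z = z} x≢z y≢z x≢y with adjacent-or-branch x≢z | adjacent-or-branch y≢z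
  ... | inj₂ branch | _           = branch
  ... | inj₁ _      | inj₂ branch = branch
  ... | inj₁ xz     | inj₁ yz     = z , 2≤degree G (Adj-sym G xz) (Adj-sym G yz) x≢y

-- Paths in forests

module _ {n : ℕ} {G : Graph n} (acyclic : Acyclic G) where
  open import Data.List.Membership.DecPropositional (_≟_ {n}) using (_∈?_)

  no-closing-edge : ∀ a b xs x → IsPath G ((a ∷ b ∷ xs) ∷ʳ x) → ¬ Adj G x a
  no-closing-edge a b xs x path xa =
    acyclic _ (s≤s (s≤s (1≤length xs)) , path , x , last-∷ʳ (a ∷ b ∷ xs) x , xa)
    where
    1≤length : ∀ xs → 1 ≤ length (xs ∷ʳ x)
    1≤length []      = s≤s z≤n
    1≤length (_ ∷ _) = s≤s z≤n

  path-unique : ∀ a p q → IsPath G (a ∷ p) → IsPath G (a ∷ q) → last (a ∷ p) ≡ last (a ∷ q) → p ≡ q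
  path-unique a []      []      _              _              _  = refl
  path-unique a []      (y ∷ q) _              (_ , a∉ ∷ _)   eq = ⊥-elim (All¬⇒¬Any a∉ (∈-last y q (sym eq)))
  path-unique a (x ∷ p) []      (_ , a∉ ∷ _)   _              eq = ⊥-elim (All¬⇒¬Any a∉ (∈-last x p eq))
  -- If the paths leave a through x ≢ y, either x lies on a ∷ y ∷ q, which closes a cycle, or
  -- x ∷ a ∷ y ∷ q is a second path from x and induction gives p ≡ a ∷ y ∷ q, repeating a.
  path-unique a (x ∷ p) (y ∷ q) ((ax , wx) , a∉ ∷ x!) pathy@((_ , wy) , _ ∷ y!) eq with x ≟ y
  ... | yes refl = cong (x ∷_) (path-unique x p q (wx , x!) (wy , y!) eq)
  ... | no x≢y with x ∈? y ∷ q
  ...   | no x∉ = ⊥-elim (All¬⇒¬Any a∉ (there (subst (a ∈_) (sym p≡ayq) (here refl))))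
    where
    x∉ayq : x ∉ a ∷ y ∷ q
    x∉ayq (here x≡a)  = Adj⇒≢ G ax (sym x≡a)
    x∉ayq (there x∈) = x∉ x∈
    p≡ayq : p ≡ a ∷ y ∷ q
    p≡ayq = path-unique x p (a ∷ y ∷ q) (wx , x!) (IsPath-∷ G (Adj-sym G ax) x∉ayq pathy) eq
  ...   | yes x∈ with ∈-∃++ x∈
  ...     | []     , _  , refl = ⊥-elim (x≢y refl)
  ...     | _ ∷ ys , zs , refl =
    ⊥-elim (no-closing-edge a y ys x (IsPath-∷ʳ⁻ G (a ∷ y ∷ ys) x zs pathy) (Adj-sym G ax))

  path-through-neighbour : ∀ {u v p} → IsPath G (u ∷ p) → Adj G u v → v ∈ p → ∃ λ q → p ≡ v ∷ q
  path-through-neighbour {u} {v} path uv v∈ with ∈-∃++ v∈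
  ... | ys , zs , refl = zs , cong (_++ v ∷ zs) ys≡[]
    where
    ys≡[] : ys ≡ []
    ys≡[] = ∷ʳ-injectiveˡ ys [] (path-unique u (ys ∷ʳ v) [ v ]
              (IsPath-∷ʳ⁻ G (u ∷ ys) v zs path) (IsPath-edge G uv) (last-∷ʳ (u ∷ ys) v))

-- Lower bound

module _ {n : ℕ} {G : Graph n} (acyclic : Acyclic G) {k : ℕ} (c : TotalColoring G k)
       (proper : TotalProperConnected G c) where
  open TotalColoring c

  internal-conditions : ∀ {a v a′} → Adj G a v → Adj G v a′ → a ≢ a′ → InternalOK G c a v a′
  internal-conditions {a} {v} {a′} av va′ a≢a′ with proper a a′
  ... | [] , (_ , () , _) , _
  ... | _ ∷ p , (path , refl , last≡) , proper-p = subst (TotalProperSeq G c) (cong (a ∷_) p≡va′) proper-p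
    where
    p≡va′ : p ≡ v ∷ a′ ∷ []
    p≡va′ = path-unique acyclic a p (v ∷ a′ ∷ []) path
              ((av , va′ , tt) , ((Adj⇒≢ G av ∷ a≢a′ ∷ []) ∷ (Adj⇒≢ G va′ ∷ []) ∷ [] ∷ [])) last≡

  vertex≢edge : ∀ {v a b₁ b₂} → Adj G v a → Adj G v b₁ → Adj G v b₂ → b₁ ≢ b₂ → vcol v ≢ ecol v a
  vertex≢edge {a = a} {b₁} {b₂} va vb₁ vb₂ b₁≢b₂ with a ≟ b₁
  ... | yes refl = proj₂ (proj₂ (internal-conditions (Adj-sym G vb₂) va (λ b₂≡a → b₁≢b₂ (sym b₂≡a))))
  ... | no a≢b₁  = proj₂ (proj₂ (internal-conditions (Adj-sym G vb₁) va (λ b₁≡a → a≢b₁ (sym b₁≡a))))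

  degree<colours : ∀ v → 2 ≤ degree G v → degree G v < k
  degree<colours v 2≤deg = subst (_< k) (sym (degree≡length-neighbours G v)) length<k
    where
    N : List (Fin n)
    N = neighbours G v
    edge-colours-distinct : Unique (map (ecol v) N)
    edge-colours-distinct = Unique-map⁺
      (λ va va′ a≢a′ eq → proj₁ (internal-conditions (Adj-sym G va) va′ a≢a′) (trans (esym _ v) eq))
      (neighbours-adjacent G v) (neighbours-unique G v)
    vertex≢edges : All (λ a → vcol v ≢ ecol v a) N
    vertex≢edges with two-distinct (neighbours-adjacent G v) (neighbours-unique G v)
                         (subst (2 ≤_) (degree≡length-neighbours G v) 2≤deg)
    ... | _ , _ , vb₁ , vb₂ , b₁≢b₂ = All.map (λ va → vertex≢edge va vb₁ vb₂ b₁≢b₂) (neighbours-adjacent G v)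
    length<k : length N < k
    length<k = subst (_≤ k) (cong suc (length-map (ecol v) N))
      (Unique⇒length≤ (vcol v ∷ map (ecol v) N) (map⁺ vertex≢edges ∷ edge-colours-distinct))

-- Rooted trees

module Rooted {n : ℕ} {G : Graph n} (tree : IsTree G) (root : Fin n) where
  open import Data.List.Membership.DecPropositional (_≟_ {n}) using (_∈?_)

  private
    connected : Connected G
    connected = proj₁ tree

    acyclic : Acyclic G
    acyclic = proj₂ tree

  RootPath : Fin n → List (Fin n) → Set
  RootPath v p = IsPath G (v ∷ p) × last (v ∷ p) ≡ just root

  RootPath-tail : ∀ {u v p} → RootPath u (v ∷ p) → RootPath v p
  RootPath-tail (((_ , w) , (_ ∷ p!)) , last≡) = (w , p!) , last≡

  ancestors : Fin n → List (Fin n)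
  ancestors v = drop 1 (proj₁ (connected v root))

  ancestors-rootPath : ∀ v → RootPath v (ancestors v)
  ancestors-rootPath v with connected v root
  ... | [] , _ , () , _
  ... | _ ∷ _ , path , refl , last≡ = path , last≡

  ancestors-unique : ∀ {v p} → RootPath v p → p ≡ ancestors v
  ancestors-unique {v} {p} (path , last≡) with ancestors-rootPath v
  ... | path′ , last≡′ = path-unique acyclic v p (ancestors v) path path′ (trans last≡ (sym last≡′))

  Parent : Fin n → Fin n → Set
  Parent u v = ancestors v ≡ u ∷ ancestors u

  Parent? : ∀ u v → Dec (Parent u v)
  Parent? u v = ≡-dec _≟_ (ancestors v) (u ∷ ancestors u)

  depth : Fin n → ℕ
  depth v = length (ancestors v)

  depth-child : ∀ {u v} → Parent u v → depth v ≡ suc (depth u)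
  depth-child = cong length

  parent-unique : ∀ {u u′ v} → Parent u v → Parent u′ v → u ≡ u′
  parent-unique e e′ = ∷-injectiveˡ (trans (sym e) e′)

  parent-asym : ∀ {u v} → Parent u v → ¬ Parent v u
  parent-asym e e′ = ℕ.1+n≰n (ℕ.≤-trans (ℕ.n≤1+n _)
    (ℕ.≤-reflexive (sym (trans (depth-child e′) (cong suc (depth-child e))))))

  parent-adjacent : ∀ {u v} → Parent u v → Adj G u v
  parent-adjacent {u} {v} e = Adj-sym G (proj₁ (proj₁ (proj₁ (subst (RootPath v) e (ancestors-rootPath v)))))

  parent-or-child : ∀ {u v} → Adj G u v → Parent u v ⊎ Parent v u
  parent-or-child {u} {v} uv with v ∈? ancestors u | ancestors-rootPath u
  ... | no v∉ | path , last≡ = inj₁ (sym (ancestors-unique (IsPath-∷ G (Adj-sym G uv) v∉u∷ path , last≡)))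
    where
    v∉u∷ : v ∉ u ∷ ancestors u
    v∉u∷ (here v≡u)  = Adj⇒≢ G uv (sym v≡u)
    v∉u∷ (there v∈) = v∉ v∈
  ... | yes v∈ | path , _ with path-through-neighbour acyclic path uv v∈
  ...   | q , anc≡ = inj₂ (trans anc≡ (cong (v ∷_)
          (ancestors-unique (RootPath-tail (subst (RootPath u) anc≡ (ancestors-rootPath u))))))

  parent-exists : ∀ v → v ≢ root → ∃ λ u → Parent u v
  parent-exists v v≢root with ancestors v | ancestors-rootPath v
  ... | []    | _ , last≡ = ⊥-elim (v≢root (just-injective last≡))
  ... | u ∷ q | rp        = u , cong (u ∷_) (ancestors-unique (RootPath-tail rp))

  deepest⇒degree≤1 : ∀ {m} → (∀ w → depth w ≤ depth m) → degree G m ≤ 1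
  deepest⇒degree≤1 {m} deepest =
    degree≤1 G (λ ma mb → parent-unique (neighbour-is-parent ma) (neighbour-is-parent mb))
    where
    neighbour-is-parent : ∀ {w} → Adj G m w → Parent w m
    neighbour-is-parent {w} mw with parent-or-child mw
    ... | inj₁ e = ⊥-elim (ℕ.1+n≰n (subst (_≤ depth m) (depth-child e) (deepest w)))
    ... | inj₂ e = e

  children : Fin n → List (Fin n)
  children u = filter (Parent? u) (neighbours G u)

  ∈-children : ∀ {u v} → Parent u v → v ∈ children u
  ∈-children {u} e = ∈-filter⁺ (Parent? u) (∈-neighbours⁺ G (parent-adjacent e)) e

  children≤degree : ∀ u → length (children u) ≤ degree G u
  children≤degree u = subst (length (children u) ≤_) (sym (degree≡length-neighbours G u))
    (length-filter (Parent? u) (neighbours G u))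

  children<degree : ∀ {u v} → Parent v u → length (children u) < degree G u
  children<degree {u} e = subst (length (children u) <_) (sym (degree≡length-neighbours G u))
    (filter-notAll (Parent? u) (neighbours G u)
      (Any.map (λ { refl → parent-asym e }) (∈-neighbours⁺ G (Adj-sym G (parent-adjacent e)))))

-- Colouring a rooted tree

module Colouring {n : ℕ} {G : Graph n} (tree : IsTree G) (root : Fin n) (k : ℕ) .{{_ : NonZero k}}
                 (degree<k : ∀ v → degree G v < k) (root-degree : 2 + degree G root ≤ k) where
  open Rooted tree root
  open ≡-Reasoning

  2+children≤k : ∀ u → 2 + length (children u) ≤ k
  2+children≤k u with u ≟ root
  ... | yes refl  = ℕ.≤-trans (ℕ.+-monoʳ-≤ 2 (children≤degree u)) root-degree
  ... | no u≢root = ℕ.≤-trans (s≤s (children<degree (proj₂ (parent-exists u u≢root)))) (degree<k u)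

  rank : Fin n → Fin n → ℕ
  rank u v = position _≟_ (children u) v

  2+rank<k : ∀ {u v} → Parent u v → 2 + rank u v < k
  2+rank<k {u} e = ℕ.<-≤-trans (s≤s (s≤s (position<length _≟_ (∈-children e)))) (2+children≤k u)

  weightAlong : Fin n → List (Fin n) → ℕ
  weightAlong v []      = 0
  weightAlong v (u ∷ p) = weightAlong u p + (2 + rank u v)

  weight : Fin n → ℕ
  weight v = weightAlong v (ancestors v)

  weight-child : ∀ {u v} → Parent u v → weight v ≡ weight u + (2 + rank u v)
  weight-child {v = v} = cong (weightAlong v)

  colour : ℕ → Fin k
  colour x = x mod k

  colour-injective : ∀ x {a b} → a < k → b < k → colour (x + a) ≡ colour (x + b) → a ≡ b
  colour-injective x a<k b<k eq =
    +-%-injectiveʳ k x a<k b<k (trans (sym (toℕ-fromℕ< _)) (trans (cong toℕ eq) (toℕ-fromℕ< _)))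

  offset : Fin n → Fin n → ℕ
  offset b w = weight b ⊔ weight w ∸ weight b

  weight-⊔ : ∀ b w → weight b ⊔ weight w ≡ weight b + offset b w
  weight-⊔ b w = sym (ℕ.m+[n∸m]≡n (ℕ.m≤m⊔n (weight b) (weight w)))

  offset-parent : ∀ {b w} → Parent w b → offset b w ≡ 0
  offset-parent {b} {w} e = begin
    weight b ⊔ weight w ∸ weight b  ≡⟨ cong (_∸ weight b) (ℕ.m≥n⇒m⊔n≡m w≤b) ⟩
    weight b ∸ weight b             ≡⟨ ℕ.n∸n≡0 (weight b) ⟩
    0                               ∎
    where
    w≤b : weight w ≤ weight b
    w≤b = subst (weight w ≤_) (sym (weight-child e)) (ℕ.m≤m+n (weight w) _)

  offset-child : ∀ {b w} → Parent b w → offset b w ≡ 2 + rank b w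
  offset-child {b} {w} e = begin
    weight b ⊔ weight w ∸ weight b        ≡⟨ cong (_∸ weight b) (ℕ.m≤n⇒m⊔n≡n b≤w) ⟩
    weight w ∸ weight b                   ≡⟨ cong (_∸ weight b) (weight-child e) ⟩
    weight b + (2 + rank b w) ∸ weight b  ≡⟨ ℕ.m+n∸m≡n (weight b) _ ⟩
    2 + rank b w                          ∎
    where
    b≤w : weight b ≤ weight w
    b≤w = subst (weight b ≤_) (sym (weight-child e)) (ℕ.m≤m+n (weight b) _)

  offset-cases : ∀ {b w} → Adj G b w → (Parent w b × offset b w ≡ 0) ⊎ (Parent b w × offset b w ≡ 2 + rank b w)
  offset-cases bw with parent-or-child bw
  ... | inj₁ e = inj₂ (e , offset-child e)
  ... | inj₂ e = inj₁ (e , offset-parent e)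

  offset<k : ∀ {b w} → Adj G b w → offset b w < k
  offset<k bw with offset-cases bw
  ... | inj₁ (_ , o≡) = subst (_< k) (sym o≡) (>-nonZero⁻¹ k)
  ... | inj₂ (e , o≡) = subst (_< k) (sym o≡) (2+rank<k e)

  offset≢1 : ∀ {b w} → Adj G b w → offset b w ≢ 1
  offset≢1 bw o≡1 with offset-cases bw
  ... | inj₁ (_ , o≡) = ℕ.0≢1+n (trans (sym o≡) o≡1)
  ... | inj₂ (_ , o≡) = ℕ.1+n≢0 (ℕ.suc-injective (trans (sym o≡) o≡1))

  offset-injective : ∀ {b w w′} → Adj G b w → Adj G b w′ → offset b w ≡ offset b w′ → w ≡ w′
  offset-injective bw bw′ eq with offset-cases bw | offset-cases bw′
  ... | inj₁ (e , _)  | inj₁ (e′ , _)  = parent-unique e e′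
  ... | inj₁ (_ , o≡) | inj₂ (_ , o≡′) = ⊥-elim (ℕ.0≢1+n (trans (sym o≡) (trans eq o≡′)))
  ... | inj₂ (_ , o≡) | inj₁ (_ , o≡′) = ⊥-elim (ℕ.0≢1+n (trans (sym o≡′) (trans (sym eq) o≡)))
  ... | inj₂ (e , o≡) | inj₂ (e′ , o≡′) = position-injective _≟_ (∈-children e) (∈-children e′)
                                            (ℕ.+-cancelˡ-≡ 2 _ _ (trans (sym o≡) (trans eq o≡′)))

  vertexColour : Fin n → Fin k
  vertexColour v = colour (weight v + 1)

  edgeColour : Fin n → Fin n → Fin k
  edgeColour u v = colour (weight u ⊔ weight v)

  edgeColour-sym : ∀ u v → edgeColour u v ≡ edgeColour v u
  edgeColour-sym u v = cong colour (ℕ.⊔-comm (weight u) (weight v))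

  edgeColour-offset : ∀ b w → edgeColour b w ≡ colour (weight b + offset b w)
  edgeColour-offset b w = cong colour (weight-⊔ b w)

  colouring : TotalColoring G k
  colouring = record { vcol = vertexColour ; ecol = edgeColour ; esym = edgeColour-sym }

  incident-edges-distinct : ∀ {a b c} → Adj G a b → Adj G b c → a ≢ c → edgeColour a b ≢ edgeColour b c
  incident-edges-distinct {a} {b} {c} ab bc a≢c eq = a≢c (offset-injective (Adj-sym G ab) bc
    (colour-injective (weight b) (offset<k (Adj-sym G ab)) (offset<k bc) (begin
      colour (weight b + offset b a)  ≡⟨ edgeColour-offset b a ⟨
      edgeColour b a                  ≡⟨ edgeColour-sym b a ⟩
      edgeColour a b                  ≡⟨ eq ⟩
      edgeColour b c                  ≡⟨ edgeColour-offset b c ⟩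
      colour (weight b + offset b c)  ∎)))

  vertex≢incident-edge : ∀ {b w} → Adj G b w → vertexColour b ≢ edgeColour b w
  vertex≢incident-edge {b} {w} bw eq = offset≢1 bw (sym (colour-injective (weight b) 1<k (offset<k bw)
    (trans eq (edgeColour-offset b w))))
    where
    1<k : 1 < k
    1<k = ℕ.m+n≤o⇒m≤o 2 root-degree

  parent≢child : ∀ {b c} → Parent b c → vertexColour b ≢ vertexColour c
  parent≢child {b} {c} e eq = ℕ.0≢1+n (colour-injective (weight b + 1) (>-nonZero⁻¹ k) (2+rank<k e) (begin
    colour (weight b + 1 + 0)               ≡⟨ cong colour (ℕ.+-identityʳ _) ⟩
    colour (weight b + 1)                   ≡⟨ eq ⟩
    colour (weight c + 1)                   ≡⟨ cong (λ x → colour (x + 1)) (weight-child e) ⟩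
    colour (weight b + (2 + rank b c) + 1)  ≡⟨ cong colour (xy∙z≈xz∙y (weight b) _ 1) ⟩
    colour (weight b + 1 + (2 + rank b c))  ∎))

  adjacent-vertices-distinct : ∀ {b c} → Adj G b c → vertexColour b ≢ vertexColour c
  adjacent-vertices-distinct bc with parent-or-child bc
  ... | inj₁ e = parent≢child e
  ... | inj₂ e = λ eq → parent≢child e (sym eq)

  internal-conditions-hold : ∀ {a b c} → Adj G a b → Adj G b c → a ≢ c → InternalOK G colouring a b c
  internal-conditions-hold {a} {b} ab bc a≢c =
    incident-edges-distinct ab bc a≢c ,
    (λ eq → vertex≢incident-edge (Adj-sym G ab) (trans eq (edgeColour-sym a b))) ,
    vertex≢incident-edge bc

  path-total-proper : ∀ p → IsPath G p → TotalProperSeq G colouring p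
  path-total-proper []                    _ = tt
  path-total-proper (_ ∷ [])              _ = tt
  path-total-proper (_ ∷ _ ∷ [])          _ = tt
  path-total-proper (_ ∷ _ ∷ _ ∷ [])      ((ab , bc , _) , (_ ∷ a≢c ∷ _) ∷ _) = internal-conditions-hold ab bc a≢c
  path-total-proper (_ ∷ b ∷ c ∷ d ∷ p) ((ab , bc , w) , (_ ∷ a≢c ∷ _) ∷ u) =
    internal-conditions-hold ab bc a≢c , adjacent-vertices-distinct bc , path-total-proper (b ∷ c ∷ d ∷ p) ((bc , w) , u)

  colouring-total-proper-connected : TotalProperConnected G colouring
  colouring-total-proper-connected u v with proj₁ tree u v
  ... | p , p-from-to = p , p-from-to , path-total-proper p (proj₁ p-from-to)

theorem1 : (n : ℕ) → 3 ≤ n → (T : Graph n) → IsTree T →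
           TPCIs T (maxDegree T + 1)
theorem1 _ (s≤s (s≤s (s≤s _))) T tree@(connected , acyclic) =
  (colouring , colouring-total-proper-connected) , fewer-colours-fail
  where
  Δ : ℕ
  Δ = maxDegree T

  degree≤Δ : ∀ v → degree T v ≤ Δ
  degree≤Δ v = ≤-foldr-⊔ (degree T) (∈-allFin v)

  2≤Δ : 2 ≤ Δ
  2≤Δ with branch-vertex connected {0F} {sucF 0F} {sucF (sucF 0F)} (λ ()) (λ ()) (λ ())
  ... | b , 2≤deg = ℕ.≤-trans 2≤deg (degree≤Δ b)

  open Rooted tree 0F using (depth; deepest⇒degree≤1)

  deepest : ∃ λ m → ∀ w → depth w ≤ depth m
  deepest with foldr-⊔-attained depth 0F (tabulate sucF)
  ... | m , max≡ = m , λ w → subst (depth w ≤_) max≡ (≤-foldr-⊔ depth (∈-allFin w))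

  open Colouring tree (proj₁ deepest) (Δ + 1) {{>-nonZero (ℕ.m≤n+m 1 Δ)}}
    (λ v → subst (suc (degree T v) ≤_) (ℕ.+-comm 1 Δ) (s≤s (degree≤Δ v)))
    (ℕ.+-mono-≤ 2≤Δ (deepest⇒degree≤1 (proj₂ deepest)))

  fewer-colours-fail : ∀ k → k < Δ + 1 → ¬ Σ (TotalColoring T k) (TotalProperConnected T)
  fewer-colours-fail k k<Δ+1 (c , proper) with foldr-⊔-attained (degree T) 0F (tabulate sucF)
  ... | v , Δ≡ = ℕ.<⇒≱ k<Δ+1 (subst (_≤ k) (ℕ.+-comm 1 Δ) (subst (_< k) (sym Δ≡)
                   (degree<colours acyclic c proper v (subst (2 ≤_) Δ≡ 2≤Δ))))
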